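{- For every $n \in \mathbb{N}$, there exists a $\Gamma_n$-symmetric $\vec y$-linear IPS refutation over $\mathbb{F}_2$ of the unsatisfiable equation system $\mathrm{CFI}(G_n, u_n, 1)$, which has size at most $O(2^{|E_n|})$, where $E_n = E(G_n)$.
   Context: Let $(G_n)_{n \in \mathbb{N}}$ be an arbitrary family of $3$-regular connected undirected graphs $G_n = (V_n, E_n)$, and let $u_n \in V_n$ be an arbitrary distinguished vertex. For a $3$-regular connected graph $G=(V,E)$, a vertex $u \in V$ and $a \in \{0,1\}$, the CFI equation system $\mathrm{CFI}(G,u,a)$ over $\mathbb{F}_2$ has variable set $X = \{x^e_i \mid e \in E, i \in \mathbb{F}_2\}$ and consists of: the equations $x^e_i + x^f_j + x^g_k = i+j+k \bmod 2$ for every $v \in V\setminus\{u\}$ with $\{e,f,g\} = E(v)$ and every $i,j,k \in \mathbb{F}_2$; the equations $x^e_i + x^f_j + x^g_k = i+j+k+a \bmod 2$ for the vertex $u$ with $\{e,f,g\}=E(u)$ and every $i,j,k\in\mathbb{F}_2$; the equations $x^e_0 + x^e_1 = 1$ for every $e \in E$; and the Boolean axioms $x^2 - x = 0$ for every variable $x \in X$. This system is satisfiable iff $a = 0$. The group $\Gamma_n$ is the subgroup of $(\mathbb{F}_2^{E_n}, \oplus)$ of all vectors $\pi$ with $\sum_{e \in E(v)} \pi_e = 0 \bmod 2$ for every vertex $v$; it acts on $X$ by $\pi(x^e_i) = x^e_{i+\pi_e}$ (addition in $\mathbb{F}_2$), and $\mathrm{CFI}(G_n,u_n,1)$ is $\Gamma_n$-invariant.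 An IPS refutation of a system $\mathcal{F} = \{f_1,\dots,f_m\} \subseteq \mathbb{F}[X]$ is an algebraic circuit over variables $X \uplus Y$, $Y = \{y_1,\dots,y_m\}$ (one variable per axiom), computing a polynomial $C(\vec x,\vec y)$ with $C(\vec x, \vec 0) = 0$ and $C(\vec x, \vec f) = 1$; it is $\vec y$-linear if $C(\vec x,\vec y) = \sum_i y_i g_i(\vec x)$. Given a group $\Gamma$ acting on $X$ with $\mathcal{F}$ $\Gamma$-invariant, $\Gamma$ acts on $Y$ by $\pi(y_i) = y_j$ where $\pi(f_i) = f_j$, and a $\Gamma$-symmetric IPS refutation is one whose circuit is $\Gamma$-symmetric, i.e. every $\pi \in \Gamma$ acting on the input gates extends to a label-preserving automorphism of the circuit. The size of a refutation is the number of gates of the circuit (counted as at least $|X|+|Y|$). -}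

module Defs where

open import Data.Nat using (ℕ; zero; suc; _+_; _*_; _⊔_)
open import Data.Fin using (Fin; zero; suc; _≟_)
open import Data.Bool using (Bool; true; false; if_then_else_; _xor_; _∧_)
open import Data.Product using (Σ; ∃; _×_; _,_; proj₁; proj₂)
open import Data.Sum using (_⊎_; inj₁; inj₂)
open import Data.List using (List; []; _∷_; _++_; map; concatMap; length; foldr)
open import Data.List using () renaming (allFin to allFinL)
open import Function using (_∘_)
open import Function.Bundles using (_↔_; Inverse)
open import Function.Definitions using (Injective)
open import Relation.Binary.PropositionalEquality using (_≡_; _≢_)
open import Relation.Nullary.Decidable using (⌊_⌋)

record Graph : Set where
  field
    nV : ℕ
    nE : ℕ
    ends : Fin nE → Fin nV × Fin nV
    loopless : ∀ e → proj₁ (ends e) ≢ proj₂ (ends e)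
    noMulti : ∀ e f →
      ((proj₁ (ends e) ≡ proj₁ (ends f)) × (proj₂ (ends e) ≡ proj₂ (ends f)))
      ⊎ ((proj₁ (ends e) ≡ proj₂ (ends f)) × (proj₂ (ends e) ≡ proj₁ (ends f)))
      → e ≡ f

open Graph public

Incident : (G : Graph) → Fin (nV G) → Fin (nE G) → Set
Incident G v e = (proj₁ (ends G e) ≡ v) ⊎ (proj₂ (ends G e) ≡ v)

data Walk (G : Graph) : Fin (nV G) → Fin (nV G) → Set where
  here : ∀ {v} → Walk G v v
  step : ∀ {v w x} (e : Fin (nE G)) → Incident G v e → Incident G w e →
         Walk G w x → Walk G v x

Connected : Graph → Set
Connected G = ∀ v w → Walk G v w

record Cubic (G : Graph) : Set where
  field
    inc : Fin (nV G) → Fin 3 → Fin (nE G)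
    inc-inj : ∀ v → Injective _≡_ _≡_ (inc v)
    inc-sound : ∀ v k → Incident G v (inc v k)
    inc-complete : ∀ v e → Incident G v e → ∃ λ k → inc v k ≡ e

open Cubic public

record CubicConnGraph : Set where
  field
    graph : Graph
    cubic : Cubic graph
    connected : Connected graph

open CubicConnGraph public

-- Polynomials over F₂: the free commutative F₂-algebra on V,
-- i.e. formal expressions modulo the commutative-ring axioms + (1+1=0).

infixl 6 _⊕_
infixl 7 _⊗_

data Expr (V : Set) : Set where
  var : V → Expr V
  𝟘 𝟙 : Expr V
  _⊕_ _⊗_ : Expr V → Expr V → Expr V

infix 4 _≈_
data _≈_ {V : Set} : Expr V → Expr V → Set where
  refl≈ : ∀ {p} → p ≈ p
  sym≈ : ∀ {p q} → p ≈ q → q ≈ p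
  trans≈ : ∀ {p q r} → p ≈ q → q ≈ r → p ≈ r
  cong⊕ : ∀ {p p' q q'} → p ≈ p' → q ≈ q' → p ⊕ q ≈ p' ⊕ q'
  cong⊗ : ∀ {p p' q q'} → p ≈ p' → q ≈ q' → p ⊗ q ≈ p' ⊗ q'
  ⊕-assoc : ∀ p q r → (p ⊕ q) ⊕ r ≈ p ⊕ (q ⊕ r)
  ⊕-comm : ∀ p q → p ⊕ q ≈ q ⊕ p
  ⊕-identity : ∀ p → p ⊕ 𝟘 ≈ p
  ⊕-self : ∀ p → p ⊕ p ≈ 𝟘                 -- characteristic 2 (so -p = p)
  ⊗-assoc : ∀ p q r → (p ⊗ q) ⊗ r ≈ p ⊗ (q ⊗ r)
  ⊗-comm : ∀ p q → p ⊗ q ≈ q ⊗ p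
  ⊗-identity : ∀ p → p ⊗ 𝟙 ≈ p
  distrib : ∀ p q r → p ⊗ (q ⊕ r) ≈ (p ⊗ q) ⊕ (p ⊗ r)

cst : ∀ {V} → Bool → Expr V
cst true = 𝟙
cst false = 𝟘

subst : ∀ {V W : Set} → (V → Expr W) → Expr V → Expr W
subst σ (var x) = σ x
subst σ 𝟘 = 𝟘
subst σ 𝟙 = 𝟙
subst σ (p ⊕ q) = subst σ p ⊕ subst σ q
subst σ (p ⊗ q) = subst σ p ⊗ subst σ q

sumFin : ∀ {V} {k} → (Fin k → Expr V) → Expr V
sumFin {k = zero} f = 𝟘
sumFin {k = suc k} f = f zero ⊕ sumFin (f ∘ suc)

prodFin : ∀ {V} {k} → (Fin k → Expr V) → Expr V
prodFin {k = zero} f = 𝟙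
prodFin {k = suc k} f = f zero ⊗ prodFin (f ∘ suc)

sumList : ∀ {V} {A : Set} → (A → Expr V) → List A → Expr V
sumList f = foldr (λ a r → f a ⊕ r) 𝟘

-- Algebraic circuits over F₂ (unbounded fan-in, children given as sets)
-- Gates of a circuit with k gates are Fin k; gate 'zero' is the most
-- recently added gate (the output); a gate only has earlier gates as children.

data Gate (Z : Set) (k : ℕ) : Set where
  input : Z → Gate Z k
  const : Bool → Gate Z k
  plus : (Fin k → Bool) → Gate Z k
  times : (Fin k → Bool) → Gate Z k

data Circuit (Z : Set) : ℕ → Set where
  [] : Circuit Z 0
  _▷_ : ∀ {k} → Circuit Z k → Gate Z k → Circuit Z (suc k)

evalGate : ∀ {Z k} → Gate Z k → (Fin k → Expr Z) → Expr Z
evalGate (input z) v = var z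
evalGate (const b) v = cst b
evalGate (plus S) v = sumFin (λ i → if S i then v i else 𝟘)
evalGate (times S) v = prodFin (λ i → if S i then v i else 𝟙)

gateVal : ∀ {Z k} → Circuit Z k → Fin k → Expr Z
gateVal (C ▷ g) zero = evalGate g (gateVal C)
gateVal (C ▷ g) (suc i) = gateVal C i

data Label (Z : Set) : Set where
  lInput : Z → Label Z
  lConst : Bool → Label Z
  lPlus lTimes : Label Z

mapLabel : ∀ {Z} → (Z → Z) → Label Z → Label Z
mapLabel ρ (lInput z) = lInput (ρ z)
mapLabel ρ (lConst b) = lConst b
mapLabel ρ lPlus = lPlus
mapLabel ρ lTimes = lTimes

gateLabel : ∀ {Z k} → Gate Z k → Label Z
gateLabel (input z) = lInput z
gateLabel (const b) = lConst b
gateLabel (plus _) = lPlus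
gateLabel (times _) = lTimes

gateChildren : ∀ {Z k} → Gate Z k → Fin k → Bool
gateChildren (input _) _ = false
gateChildren (const _) _ = false
gateChildren (plus S) = S
gateChildren (times S) = S

labelOf : ∀ {Z k} → Circuit Z k → Fin k → Label Z
labelOf (C ▷ g) zero = gateLabel g
labelOf (C ▷ g) (suc i) = labelOf C i

childOf : ∀ {Z k} → Circuit Z k → Fin k → Fin k → Bool
childOf (C ▷ g) zero zero = false
childOf (C ▷ g) zero (suc h) = gateChildren g h
childOf (C ▷ g) (suc i) zero = false
childOf (C ▷ g) (suc i) (suc h) = childOf C i h

IsAutExtending : ∀ {Z k} → Circuit Z (suc k) → (Z → Z) → (Fin (suc k) ↔ Fin (suc k)) → Set
IsAutExtending C ρ σ =
  (∀ g → labelOf C (Inverse.to σ g) ≡ mapLabel ρ (labelOf C g))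
  × (∀ g h → childOf C (Inverse.to σ g) (Inverse.to σ h) ≡ childOf C g h)
  × (Inverse.to σ zero ≡ zero)

module _ (H : CubicConnGraph) where
  private
    G = graph H
    cub = cubic H

  XVar : Set
  XVar = Fin (nE G) × Bool

  -- axiom indices (one y-variable per axiom)
  data Ax : Set where
    vtxAx : Fin (nV G) → Bool → Bool → Bool → Ax  -- vertex v, bits i j k for inc v 0,1,2
    edgAx : Fin (nE G) → Ax
    booAx : Fin (nE G) → Bool → Ax

  bools : List Bool
  bools = false ∷ true ∷ []

  allAx : List Ax
  allAx =
    concatMap (λ v → concatMap (λ i → concatMap (λ j → map (λ k → vtxAx v i j k) bools) bools) bools) (allFinL (nV G))
    ++ map edgAx (allFinL (nE G))
    ++ concatMap (λ e → map (λ i → booAx e i) bools) (allFinL (nE G))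

  -- the polynomial of each axiom of CFI(G,u,a) (equation lhs = rhs written as lhs - rhs)
  cfiPoly : Fin (nV G) → Bool → Ax → Expr XVar
  cfiPoly u a (vtxAx v i j k) =
    var (inc cub v zero , i) ⊕ var (inc cub v (suc zero) , j) ⊕ var (inc cub v (suc (suc zero)) , k)
    ⊕ cst (i xor j xor k xor (a ∧ ⌊ v ≟ u ⌋))
  cfiPoly u a (edgAx e) = var (e , false) ⊕ var (e , true) ⊕ 𝟙
  cfiPoly u a (booAx e i) = var (e , i) ⊗ var (e , i) ⊕ var (e , i)

  InΓ : (Fin (nE G) → Bool) → Set
  InΓ π = ∀ v → (π (inc cub v zero) xor π (inc cub v (suc zero)) xor π (inc cub v (suc (suc zero)))) ≡ false

  actX : (Fin (nE G) → Bool) → XVar → XVar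
  actX π (e , i) = (e , i xor π e)

  -- induced action on axioms: π(y_i) = y_j where π(f_i) = f_j
  actY : (Fin (nE G) → Bool) → Ax → Ax
  actY π (vtxAx v i j k) =
    vtxAx v (i xor π (inc cub v zero)) (j xor π (inc cub v (suc zero))) (k xor π (inc cub v (suc (suc zero))))
  actY π (edgAx e) = edgAx e
  actY π (booAx e i) = booAx e (i xor π e)

  actZ : (Fin (nE G) → Bool) → XVar ⊎ Ax → XVar ⊎ Ax
  actZ π (inj₁ x) = inj₁ (actX π x)
  actZ π (inj₂ y) = inj₂ (actY π y)

  record SymLinIPSRefutation (u : Fin (nV G)) (a : Bool) : Set where
    field
      s : ℕ
      circuit : Circuit (XVar ⊎ Ax) (suc s)
    out : Expr (XVar ⊎ Ax)
    out = gateVal circuit zero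
    field
      at-zero : subst (λ { (inj₁ x) → var x ; (inj₂ y) → 𝟘 }) out ≈ 𝟘
      at-axioms : subst (λ { (inj₁ x) → var x ; (inj₂ y) → cfiPoly u a y }) out ≈ 𝟙
      y-linear : Σ (Ax → Expr XVar) λ g →
        out ≈ sumList (λ y → var (inj₂ y) ⊗ subst (var ∘ inj₁) (g y)) allAx
      symmetric : ∀ π → InΓ π →
        Σ (Fin (suc s) ↔ Fin (suc s)) λ σ → IsAutExtending circuit (actZ π) σ

  -- size = number of gates, counted as at least |X| + |Y|
  size : ∀ {u a} → SymLinIPSRefutation u a → ℕ
  size R = suc (SymLinIPSRefutation.s R) ⊔ (2 * nE G + length allAx)

-- The refutation is y-linear with coefficients
--   g(v,i,j,k) = x^{e₀}_{¬i} x^{e₁}_{¬j} x^{e₂}_{¬k} · ∏_{e ∉ E(v)} s_e ,   g(e) = ∏_{e' < e} s_{e'} ,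
-- and 0 for the Boolean axioms, where E(v) = {e₀, e₁, e₂} and s_e = x^e_0 + x^e_1.  Summed over the
-- eight axioms f of a vertex v, f·g leaves ∑_{e ∈ E(v)} x^e_0 ∏_{e' ≠ e} s_{e'} + [v = u] ∏_e s_e; summed over
-- all vertices the first part cancels, since every edge has two endpoints and we are in characteristic 2.
-- The edge axioms telescope to 1 + ∏_e s_e, so ∑ f·g = 1.  Computing every g by one product gate over
-- literals and the sum gates s_e gives a circuit with O(|V| + |E|) gates, and flipping x^e_0 ↔ x^e_1
-- only permutes the vertex gates (v,i,j,k) among themselves, together with their axioms.

module Submission where

open import Defs
open import Algebra.Bundles using (CommutativeMonoid; CommutativeSemiring; RawRing)
open import Algebra.Structures using (IsCommutativeMonoid; IsCommutativeSemiring)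
open import Algebra.Structures.Biased using (isCommutativeMonoidʳ; isCommutativeSemiringʳ)
open import Algebra.Solver.Ring.AlmostCommutativeRing
  using (AlmostCommutativeRing; _-Raw-AlmostCommutative⟶_; Induced-equivalence)
import Algebra.Solver.Ring
import Algebra.Properties.CommutativeMonoid.Sum as MonoidSum
import Algebra.Properties.CommutativeSemigroup as CommutativeSemigroupProperties
import Algebra.Properties.Semiring.Sum as SemiringSum
open import Data.Bool using (Bool; true; false; if_then_else_; not; _xor_; _∧_; _∨_; T)
import Data.Bool.Properties as Bool
open import Data.Empty using (⊥-elim)
open import Data.Fin using (Fin; zero; suc; toℕ; _≟_; _↑ˡ_; _↑ʳ_; splitAt; join; combine; remQuot)
import Data.Fin.Properties as Fin
open import Data.Fin.Properties using (_<?_)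
open import Data.List using (List; []; _∷_; _++_; length; foldr; map; concatMap; tabulate; allFin)
import Data.List.Properties as List
import Data.List.Membership.DecPropositional as DecMembership
open import Data.List.Membership.Propositional using (_∈_; _∉_)
open import Data.List.Membership.Propositional.Properties using (∈-map⁺; ∈-map⁻)
open import Data.List.Relation.Binary.Permutation.Propositional using (_↭_; ↭-sym; ↭-refl; ↭-trans; prep; swap)
open import Data.List.Relation.Binary.Permutation.Propositional.Properties using (∈-resp-↭; ↭-reverse)
open import Data.List.Relation.Unary.All using ([]; _∷_)
open import Data.List.Relation.Unary.All.Properties using (All¬⇒¬Any)
open import Data.List.Relation.Unary.AllPairs using ([]; _∷_)
open import Data.List.Relation.Unary.Any using (here; there)
open import Data.List.Relation.Unary.Unique.Propositional using (Unique)
import Data.List.Relation.Unary.Unique.Propositional.Properties as Unique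
open import Data.Maybe using (just; nothing)
open import Data.Nat using (ℕ; zero; suc; _+_; _*_; _^_; _≤_; _<_; _<ᵇ_; z≤n; s≤s)
import Data.Nat.Properties as ℕ
open import Data.Nat.Tactic.RingSolver using (solve-∀)
open import Data.Product using (Σ; ∃; _×_; _,_; proj₁; proj₂; uncurry)
import Data.Product as Product
open import Data.Product.Properties using (,-injective)
open import Data.Sum using (_⊎_; inj₁; inj₂; [_,_]′) renaming (map to ⊎-map)
import Data.Sum.Properties as Sum
open import Function using (_∘_; id; _⇔_; mk⇔)
open import Function.Bundles using (_↔_; mk↔ₛ′)
open import Relation.Binary.Definitions using (DecidableEquality; WeaklyDecidable)
open import Relation.Binary.PropositionalEquality as ≡ using (_≡_; _≢_; refl; cong; cong₂; ≢-sym)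
import Relation.Binary.Reasoning.Setoid as SetoidReasoning
open import Relation.Binary.Structures using (IsEquivalence)
open import Relation.Nullary using (does; yes; no; _⊎-dec_)
open import Relation.Nullary.Decidable using (map′; _×-dec_; does-⇔; dec-true; dec-false; ⌊_⌋; isYes≗does)

module _ {V : Set} where

  ≈-isEquivalence : IsEquivalence (_≈_ {V})
  ≈-isEquivalence = record { refl = refl≈ ; sym = sym≈ ; trans = trans≈ }

  private
    ⊕-isCommutativeMonoid : IsCommutativeMonoid (_≈_ {V}) _⊕_ 𝟘
    ⊕-isCommutativeMonoid = isCommutativeMonoidʳ record
      { isSemigroup = record
        { isMagma = record { isEquivalence = ≈-isEquivalence ; ∙-cong = cong⊕ }
        ; assoc = ⊕-assoc }
      ; identityʳ = ⊕-identity
      ; comm = ⊕-comm }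

    ⊗-isCommutativeMonoid : IsCommutativeMonoid (_≈_ {V}) _⊗_ 𝟙
    ⊗-isCommutativeMonoid = isCommutativeMonoidʳ record
      { isSemigroup = record
        { isMagma = record { isEquivalence = ≈-isEquivalence ; ∙-cong = cong⊗ }
        ; assoc = ⊗-assoc }
      ; identityʳ = ⊗-identity
      ; comm = ⊗-comm }

    ⊗-zeroʳ : ∀ (p : Expr V) → p ⊗ 𝟘 ≈ 𝟘
    ⊗-zeroʳ p = trans≈ (cong⊗ refl≈ (sym≈ (⊕-identity 𝟘))) (trans≈ (distrib p 𝟘 𝟘) (⊕-self _))

  ⊕-⊗-isCommutativeSemiring : IsCommutativeSemiring (_≈_ {V}) _⊕_ _⊗_ 𝟘 𝟙
  ⊕-⊗-isCommutativeSemiring = isCommutativeSemiringʳ record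
    { +-isCommutativeMonoid = ⊕-isCommutativeMonoid
    ; *-isCommutativeMonoid = ⊗-isCommutativeMonoid
    ; distribˡ = distrib
    ; zeroʳ = ⊗-zeroʳ }

⊕-⊗-commutativeSemiring : Set → CommutativeSemiring _ _
⊕-⊗-commutativeSemiring V = record { isCommutativeSemiring = ⊕-⊗-isCommutativeSemiring {V} }

module Poly {V : Set} = CommutativeSemiring (⊕-⊗-commutativeSemiring V)
module ≈-Reasoning {V : Set} = SetoidReasoning (Poly.setoid {V})

⊕-commutativeMonoid ⊗-commutativeMonoid : Set → CommutativeMonoid _ _
⊕-commutativeMonoid V = Poly.+-commutativeMonoid {V}
⊗-commutativeMonoid V = Poly.*-commutativeMonoid {V}

F₂ : RawRing _ _
F₂ = record { Carrier = Bool ; _≈_ = _≡_ ; _+_ = _xor_ ; _*_ = _∧_ ; -_ = λ x → x ; 0# = false ; 1# = true }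

module _ {V : Set} where

  cst-xor : ∀ a b → cst {V} (a xor b) ≈ cst a ⊕ cst b
  cst-xor false b = sym≈ (Poly.+-identityˡ _)
  cst-xor true false = sym≈ (⊕-identity _)
  cst-xor true true = sym≈ (⊕-self _)

  cst-∧ : ∀ a b → cst {V} (a ∧ b) ≈ cst a ⊗ cst b
  cst-∧ false b = sym≈ (Poly.zeroˡ _)
  cst-∧ true b = sym≈ (Poly.*-identityˡ _)

  -- In characteristic 2 negation is the identity, so Expr V is a commutative ring.
  ⊕-⊗-almostCommutativeRing : AlmostCommutativeRing _ _
  ⊕-⊗-almostCommutativeRing = record
    { isAlmostCommutativeRing = record
      { isCommutativeSemiring = ⊕-⊗-isCommutativeSemiring {V}
      ; -‿cong = λ p≈q → p≈q
      ; -‿*-distribˡ = λ _ _ → refl≈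
      ; -‿+-comm = λ _ _ → refl≈ }
    ; -_ = λ p → p }

  cst-homomorphism : F₂ -Raw-AlmostCommutative⟶ ⊕-⊗-almostCommutativeRing
  cst-homomorphism = record
    { ⟦_⟧ = cst ; +-homo = cst-xor ; *-homo = cst-∧ ; -‿homo = λ _ → refl≈ ; 0-homo = refl≈ ; 1-homo = refl≈ }

  private
    cst-≟ : WeaklyDecidable (Induced-equivalence cst-homomorphism)
    cst-≟ false false = just refl≈
    cst-≟ true true = just refl≈
    cst-≟ _ _ = nothing

  open Algebra.Solver.Ring F₂ ⊕-⊗-almostCommutativeRing cst-homomorphism cst-≟ public
    using (Polynomial; solve; _:+_; _:*_; _:=_; con)

module _ {V W : Set} (σ : V → Expr W) where

  subst-cong : ∀ {p q} → p ≈ q → subst σ p ≈ subst σ q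
  subst-cong refl≈ = refl≈
  subst-cong (sym≈ p≈q) = sym≈ (subst-cong p≈q)
  subst-cong (trans≈ p≈q q≈r) = trans≈ (subst-cong p≈q) (subst-cong q≈r)
  subst-cong (cong⊕ p≈q p'≈q') = cong⊕ (subst-cong p≈q) (subst-cong p'≈q')
  subst-cong (cong⊗ p≈q p'≈q') = cong⊗ (subst-cong p≈q) (subst-cong p'≈q')
  subst-cong (⊕-assoc _ _ _) = ⊕-assoc _ _ _
  subst-cong (⊕-comm _ _) = ⊕-comm _ _
  subst-cong (⊕-identity _) = ⊕-identity _
  subst-cong (⊕-self _) = ⊕-self _
  subst-cong (⊗-assoc _ _ _) = ⊗-assoc _ _ _
  subst-cong (⊗-comm _ _) = ⊗-comm _ _
  subst-cong (⊗-identity _) = ⊗-identity _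
  subst-cong (distrib _ _ _) = distrib _ _ _

  subst-sumList : ∀ {A : Set} (f : A → Expr V) xs → subst σ (sumList f xs) ≡ sumList (subst σ ∘ f) xs
  subst-sumList f [] = refl
  subst-sumList f (x ∷ xs) = cong (subst σ (f x) ⊕_) (subst-sumList f xs)

subst-subst : ∀ {U V W : Set} (τ : V → Expr W) (σ : U → Expr V) p → subst τ (subst σ p) ≡ subst (subst τ ∘ σ) p
subst-subst τ σ (var x) = refl
subst-subst τ σ 𝟘 = refl
subst-subst τ σ 𝟙 = refl
subst-subst τ σ (p ⊕ q) = cong₂ _⊕_ (subst-subst τ σ p) (subst-subst τ σ q)
subst-subst τ σ (p ⊗ q) = cong₂ _⊗_ (subst-subst τ σ p) (subst-subst τ σ q)

subst-var : ∀ {V : Set} (p : Expr V) → subst var p ≡ p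
subst-var (var x) = refl
subst-var 𝟘 = refl
subst-var 𝟙 = refl
subst-var (p ⊕ q) = cong₂ _⊕_ (subst-var p) (subst-var q)
subst-var (p ⊗ q) = cong₂ _⊗_ (subst-var p) (subst-var q)

infixr 4 _⊞_
infixr 5 _⊠_

data Code : Set where
  fin : ℕ → Code
  bool : Code
  _⊞_ _⊠_ : Code → Code → Code

El : Code → Set
El (fin n) = Fin n
El bool = Bool
El (a ⊞ b) = El a ⊎ El b
El (a ⊠ b) = El a × El b

card : Code → ℕ
card (fin n) = n
card bool = 2
card (a ⊞ b) = card a + card b
card (a ⊠ b) = card a * card b

encode : ∀ c → El c → Fin (card c)
encode (fin n) x = x
encode bool false = zero
encode bool true = suc zero
encode (a ⊞ b) (inj₁ x) = encode a x ↑ˡ card b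
encode (a ⊞ b) (inj₂ y) = card a ↑ʳ encode b y
encode (a ⊠ b) (x , y) = combine (encode a x) (encode b y)

decode : ∀ c → Fin (card c) → El c
decode (fin n) i = i
decode bool zero = false
decode bool (suc _) = true
decode (a ⊞ b) i = [ inj₁ ∘ decode a , inj₂ ∘ decode b ]′ (splitAt (card a) i)
decode (a ⊠ b) i = Product.map (decode a) (decode b) (remQuot (card b) i)

decode-encode : ∀ c x → decode c (encode c x) ≡ x
decode-encode (fin n) x = refl
decode-encode bool false = refl
decode-encode bool true = refl
decode-encode (a ⊞ b) (inj₁ x)
  rewrite Fin.splitAt-↑ˡ (card a) (encode a x) (card b) = cong inj₁ (decode-encode a x)
decode-encode (a ⊞ b) (inj₂ y)
  rewrite Fin.splitAt-↑ʳ (card a) (card b) (encode b y) = cong inj₂ (decode-encode b y)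
decode-encode (a ⊠ b) (x , y) =
  ≡.trans (cong (Product.map (decode a) (decode b)) (Fin.remQuot-combine (encode a x) (encode b y)))
          (cong₂ _,_ (decode-encode a x) (decode-encode b y))

encode-decode : ∀ c i → encode c (decode c i) ≡ i
encode-decode (fin n) i = refl
encode-decode bool zero = refl
encode-decode bool (suc zero) = refl
encode-decode (a ⊞ b) i = ≡.trans (encode-split (splitAt (card a) i)) (Fin.join-splitAt (card a) (card b) i)
  where
  encode-split : ∀ s → encode (a ⊞ b) ([ inj₁ ∘ decode a , inj₂ ∘ decode b ]′ s) ≡ join (card a) (card b) s
  encode-split (inj₁ j) = cong (_↑ˡ card b) (encode-decode a j)
  encode-split (inj₂ k) = cong (card a ↑ʳ_) (encode-decode b k)
encode-decode (a ⊠ b) i =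
  ≡.trans (cong₂ combine (encode-decode a _) (encode-decode b _)) (Fin.combine-remQuot {card a} (card b) i)

≟ᶜ : ∀ c → DecidableEquality (El c)
≟ᶜ (fin n) = Fin._≟_
≟ᶜ bool = Bool._≟_
≟ᶜ (a ⊞ b) = Sum.≡-dec (≟ᶜ a) (≟ᶜ b)
≟ᶜ (a ⊠ b) (x , y) (x' , y') = map′ (uncurry (cong₂ _,_)) ,-injective (≟ᶜ a x x' ×-dec ≟ᶜ b y y')

spine : ∀ c → El c → ℕ
spine (a ⊞ b) (inj₁ _) = 0
spine (a ⊞ b) (inj₂ y) = suc (spine b y)
spine _ _ = 0

spine-< : ∀ c t t' → spine c t < spine c t' → toℕ (encode c t) < toℕ (encode c t')
spine-< (a ⊞ b) (inj₁ x) (inj₂ y) _ = begin-strict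
  toℕ (encode a x ↑ˡ card b)   ≡⟨ Fin.toℕ-↑ˡ (encode a x) (card b) ⟩
  toℕ (encode a x)             <⟨ Fin.toℕ<n (encode a x) ⟩
  card a                       ≤⟨ ℕ.m≤m+n (card a) (toℕ (encode b y)) ⟩
  card a + toℕ (encode b y)    ≡⟨ Fin.toℕ-↑ʳ (card a) (encode b y) ⟨
  toℕ (card a ↑ʳ encode b y)   ∎
  where open ℕ.≤-Reasoning
spine-< (a ⊞ b) (inj₂ x) (inj₂ y) (s≤s x<y) = begin-strict
  toℕ (card a ↑ʳ encode b x)   ≡⟨ Fin.toℕ-↑ʳ (card a) (encode b x) ⟩
  card a + toℕ (encode b x)    <⟨ ℕ.+-monoʳ-< (card a) (spine-< b x y x<y) ⟩
  card a + toℕ (encode b y)    ≡⟨ Fin.toℕ-↑ʳ (card a) (encode b y) ⟨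
  toℕ (card a ↑ʳ encode b y)   ∎
  where open ℕ.≤-Reasoning

module _ {c : Code} {f : El c → El c} (f-injective : ∀ {x y} → f x ≡ f y → x ≡ y) where
  open DecMembership (≟ᶜ c) using (_∈?_)

  does-≟-injective : ∀ x y → does (≟ᶜ c (f x) (f y)) ≡ does (≟ᶜ c x y)
  does-≟-injective x y = does-⇔ (mk⇔ f-injective (cong f)) (≟ᶜ c (f x) (f y)) (≟ᶜ c x y)

  does-∈-map-injective : ∀ x xs → does (f x ∈? map f xs) ≡ does (x ∈? xs)
  does-∈-map-injective x xs = does-⇔ (mk⇔ from (∈-map⁺ f)) (f x ∈? map f xs) (x ∈? xs)
    where
    from : f x ∈ map f xs → x ∈ xs
    from fx∈ with ∈-map⁻ f fx∈
    ... | y , y∈xs , fx≡fy = ≡.subst (_∈ xs) (≡.sym (f-injective fx≡fy)) y∈xs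

module BigOperator {a ℓ} (M : CommutativeMonoid a ℓ) where

  open CommutativeMonoid M renaming (_≈_ to _≈ᴹ_; refl to ≈ᴹ-refl)
  open MonoidSum M public using () renaming (sum to fold; ∑-comm to fold-comm)
  open MonoidSum M using (sum-cong-≋; ∑-distrib-+; sum-replicate-zero)
  open CommutativeSemigroupProperties commutativeSemigroup using (interchange)

  big : ∀ c → (El c → Carrier) → Carrier
  big (fin n) f = fold f
  big bool f = fold (f ∘ decode bool)
  big (a ⊞ b) f = big a (f ∘ inj₁) ∙ big b (f ∘ inj₂)
  big (a ⊠ b) f = big a (λ x → big b (λ y → f (x , y)))

  big-cong : ∀ c {f g : El c → Carrier} → (∀ x → f x ≈ᴹ g x) → big c f ≈ᴹ big c g
  big-cong (fin n) f≈g = sum-cong-≋ f≈g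
  big-cong bool f≈g = sum-cong-≋ (f≈g ∘ decode bool)
  big-cong (a ⊞ b) f≈g = ∙-cong (big-cong a (f≈g ∘ inj₁)) (big-cong b (f≈g ∘ inj₂))
  big-cong (a ⊠ b) f≈g = big-cong a (λ x → big-cong b (λ y → f≈g (x , y)))

  big-ε : ∀ c → big c (λ _ → ε) ≈ᴹ ε
  big-ε (fin n) = sum-replicate-zero n
  big-ε bool = sum-replicate-zero 2
  big-ε (a ⊞ b) = trans (∙-cong (big-ε a) (big-ε b)) (identityʳ ε)
  big-ε (a ⊠ b) = trans (big-cong a (λ _ → big-ε b)) (big-ε a)

  big-∙ : ∀ c (f g : El c → Carrier) → big c (λ x → f x ∙ g x) ≈ᴹ big c f ∙ big c g
  big-∙ (fin n) f g = ∑-distrib-+ f g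
  big-∙ bool f g = ∑-distrib-+ (f ∘ decode bool) (g ∘ decode bool)
  big-∙ (a ⊞ b) f g = trans (∙-cong (big-∙ a _ _) (big-∙ b _ _)) (interchange _ _ _ _)
  big-∙ (a ⊠ b) f g = trans (big-cong a (λ x → big-∙ b _ _)) (big-∙ a _ _)

  big-ε-∙ : ∀ c {x y} → x ≈ᴹ y → big c (λ _ → ε) ∙ x ≈ᴹ y
  big-ε-∙ c x≈y = trans (∙-cong (big-ε c) x≈y) (identityˡ _)

  big-if : ∀ c b (f : El c → Carrier) → big c (λ x → if b then f x else ε) ≈ᴹ (if b then big c f else ε)
  big-if c false f = big-ε c
  big-if c true f = ≈ᴹ-refl

  big-point : ∀ c p (f : El c → Carrier) → big c (λ x → if does (≟ᶜ c x p) then f x else ε) ≈ᴹ f p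
  big-point (fin (suc n)) zero f = trans (∙-congˡ (sum-replicate-zero n)) (identityʳ _)
  big-point (fin (suc n)) (suc p) f = trans (identityˡ _) (big-point (fin n) p (f ∘ suc))
  big-point bool false f = trans (∙-congˡ (identityˡ ε)) (identityʳ _)
  big-point bool true f = trans (identityˡ _) (identityʳ _)
  big-point (a ⊞ b) (inj₁ p) f = trans (∙-congˡ (big-ε b)) (trans (identityʳ _) (big-point a p (f ∘ inj₁)))
  big-point (a ⊞ b) (inj₂ p) f = trans (∙-congʳ (big-ε a)) (trans (identityˡ _) (big-point b p (f ∘ inj₂)))
  big-point (a ⊠ b) (p , q) f = trans (big-cong a row) (big-point a p (λ x → f (x , q)))
    where
    row : ∀ x → big b (λ y → if does (≟ᶜ a x p) ∧ does (≟ᶜ b y q) then f (x , y) else ε)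
              ≈ᴹ (if does (≟ᶜ a x p) then f (x , q) else ε)
    row x with does (≟ᶜ a x p)
    ... | true = big-point b q (λ y → f (x , y))
    ... | false = big-ε b

  big-point-∨ : ∀ c p (g : El c → Bool) → g p ≡ false → (f : El c → Carrier) →
                big c (λ x → if does (≟ᶜ c x p) ∨ g x then f x else ε)
                ≈ᴹ f p ∙ big c (λ x → if g x then f x else ε)
  big-point-∨ c p g gp≡false f = trans (big-cong c split) (trans (big-∙ c _ _) (∙-congʳ (big-point c p f)))
    where
    split : ∀ x → (if does (≟ᶜ c x p) ∨ g x then f x else ε)
                ≈ᴹ (if does (≟ᶜ c x p) then f x else ε) ∙ (if g x then f x else ε)
    split x with ≟ᶜ c x p
    ... | yes ≡.refl rewrite gp≡false = sym (identityʳ _)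
    ... | no _ = sym (identityˡ _)

  module _ (c : Code) where
    open DecMembership (≟ᶜ c) using (_∈?_; _∉?_)

    big-∈ : ∀ {xs} → Unique xs → (f : El c → Carrier) →
            big c (λ x → if does (x ∈? xs) then f x else ε) ≈ᴹ foldr _∙_ ε (map f xs)
    big-∈ [] f = big-ε c
    big-∈ {y ∷ ys} (y∉ys ∷ ys-unique) f =
      trans (big-point-∨ c y _ (dec-false (y ∈? ys) (All¬⇒¬Any y∉ys)) f) (∙-congˡ (big-∈ ys-unique f))

    big-∉-∷ : ∀ {y xs} → y ∉ xs → (f : El c → Carrier) →
              big c (λ x → if does (x ∉? xs) then f x else ε)
              ≈ᴹ f y ∙ big c (λ x → if does (x ∉? (y ∷ xs)) then f x else ε)
    big-∉-∷ {y} {xs} y∉xs f = trans (big-cong c same) (big-point-∨ c y _ y∈y∷xs f)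
      where
      same : ∀ x → (if does (x ∉? xs) then f x else ε)
                 ≈ᴹ (if does (≟ᶜ c x y) ∨ does (x ∉? (y ∷ xs)) then f x else ε)
      same x with ≟ᶜ c x y
      ... | yes ≡.refl rewrite dec-false (x ∈? xs) y∉xs = ≈ᴹ-refl
      ... | no _ = ≈ᴹ-refl
      y∈y∷xs : does (y ∉? (y ∷ xs)) ≡ false
      y∈y∷xs = cong not (dec-true (y ∈? (y ∷ xs)) (here ≡.refl))

    big-∉-↭ : ∀ {xs ys} → xs ↭ ys → (f : El c → Carrier) →
              big c (λ x → if does (x ∉? xs) then f x else ε) ≈ᴹ big c (λ x → if does (x ∉? ys) then f x else ε)
    big-∉-↭ {xs} {ys} xs↭ys f = big-cong c λ x →
      reflexive (cong (λ b → if not b then f x else ε) (does-⇔ ∈-resp-↭-⇔ (x ∈? xs) (x ∈? ys)))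
      where
      ∈-resp-↭-⇔ : ∀ {x} → (x ∈ xs) ⇔ (x ∈ ys)
      ∈-resp-↭-⇔ = mk⇔ (∈-resp-↭ xs↭ys) (∈-resp-↭ (↭-sym xs↭ys))

    big-∉-singleton : ∀ {x y z ws} → x ≢ y → x ≢ z → y ≢ z → z ∷ y ∷ x ∷ [] ↭ ws → (f : El c → Carrier) →
      big c (λ w → if does (w ∉? (x ∷ [])) then f w else ε)
      ≈ᴹ f y ∙ (f z ∙ big c (λ w → if does (w ∉? ws) then f w else ε))
    big-∉-singleton x≢y x≢z y≢z zyx↭ws f =
      trans (big-∉-∷ (All¬⇒¬Any (≢-sym x≢y ∷ [])) f)
      (∙-congˡ (trans (big-∉-∷ (All¬⇒¬Any (≢-sym y≢z ∷ ≢-sym x≢z ∷ [])) f)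
      (∙-congˡ (big-∉-↭ zyx↭ws f))))

  fold-↑ : ∀ m {n} (f : Fin (m + n) → Carrier) → fold f ≈ᴹ fold (f ∘ (_↑ˡ n)) ∙ fold (f ∘ (m ↑ʳ_))
  fold-↑ zero f = sym (identityˡ _)
  fold-↑ (suc m) f = trans (∙-congˡ (fold-↑ m (f ∘ suc))) (sym (assoc _ _ _))

  fold-combine : ∀ m {n} (f : Fin (m * n) → Carrier) →
                 fold f ≈ᴹ fold (λ i → fold (λ j → f (combine {m} {n} i j)))
  fold-combine zero f = ≈ᴹ-refl
  fold-combine (suc m) {n} f = trans (fold-↑ n f) (∙-congˡ (fold-combine m {n} (f ∘ (n ↑ʳ_))))

  fold≈big : ∀ c (f : Fin (card c) → Carrier) → fold f ≈ᴹ big c (f ∘ encode c)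
  fold≈big (fin n) f = ≈ᴹ-refl
  fold≈big bool f = ≈ᴹ-refl
  fold≈big (a ⊞ b) f = trans (fold-↑ (card a) f) (∙-cong (fold≈big a _) (fold≈big b _))
  fold≈big (a ⊠ b) f = trans (fold-combine (card a) {card b} f)
    (trans (sum-cong-≋ {card a} (λ i → fold≈big b (λ j → f (combine i j)))) (fold≈big a _))

module ⨁ {V : Set} = BigOperator (⊕-commutativeMonoid V)
module ⨂ {V : Set} = BigOperator (⊗-commutativeMonoid V)

module _ {V : Set} where

  sumFin≈fold : ∀ {n} (f : Fin n → Expr V) → sumFin f ≈ ⨁.fold f
  sumFin≈fold {n = zero} f = refl≈
  sumFin≈fold {n = suc n} f = cong⊕ refl≈ (sumFin≈fold (f ∘ suc))

  prodFin≈fold : ∀ {n} (f : Fin n → Expr V) → prodFin f ≈ ⨂.fold f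
  prodFin≈fold {n = zero} f = refl≈
  prodFin≈fold {n = suc n} f = cong⊗ refl≈ (prodFin≈fold (f ∘ suc))

if-cong : ∀ {V} b {p q r : Expr V} → p ≈ q → (if b then p else r) ≈ (if b then q else r)
if-cong false _ = refl≈
if-cong true p≈q = p≈q

module _ {V A : Set} where

  sumList-cong : ∀ {f g : A → Expr V} xs → (∀ x → f x ≈ g x) → sumList f xs ≈ sumList g xs
  sumList-cong [] f≈g = refl≈
  sumList-cong (x ∷ xs) f≈g = cong⊕ (f≈g x) (sumList-cong xs f≈g)

  sumList-++ : ∀ (f : A → Expr V) xs ys → sumList f (xs ++ ys) ≈ sumList f xs ⊕ sumList f ys
  sumList-++ f [] ys = sym≈ (Poly.+-identityˡ _)
  sumList-++ f (x ∷ xs) ys = trans≈ (cong⊕ refl≈ (sumList-++ f xs ys)) (sym≈ (⊕-assoc _ _ _))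

  sumList-concatMap : ∀ {B : Set} (f : A → Expr V) (g : B → List A) xs →
                      sumList f (concatMap g xs) ≈ sumList (sumList f ∘ g) xs
  sumList-concatMap f g [] = refl≈
  sumList-concatMap f g (x ∷ xs) = trans≈ (sumList-++ f (g x) _) (cong⊕ refl≈ (sumList-concatMap f g xs))

  sumList-map : ∀ {B : Set} (f : A → Expr V) (g : B → A) xs → sumList f (map g xs) ≡ sumList (f ∘ g) xs
  sumList-map f g [] = refl
  sumList-map f g (x ∷ xs) = cong (f (g x) ⊕_) (sumList-map f g xs)

  sumList-zero : ∀ (f : A → Expr V) xs → (∀ x → f x ≈ 𝟘) → sumList f xs ≈ 𝟘
  sumList-zero f [] f≈𝟘 = refl≈
  sumList-zero f (x ∷ xs) f≈𝟘 = trans≈ (cong⊕ (f≈𝟘 x) (sumList-zero f xs f≈𝟘)) (⊕-identity 𝟘)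

sumList-tabulate : ∀ {V A : Set} {n} (f : A → Expr V) (g : Fin n → A) → sumList f (tabulate g) ≈ ⨁.fold (f ∘ g)
sumList-tabulate {n = zero} f g = refl≈
sumList-tabulate {n = suc n} f g = cong⊕ refl≈ (sumList-tabulate f (g ∘ suc))

subst-fold-if : ∀ {V W : Set} (σ : V → Expr W) {n} (b : Fin n → Bool) (f : Fin n → Expr V) →
  subst σ (⨂.fold (λ e → if b e then f e else 𝟙)) ≡ ⨂.fold (λ e → if b e then subst σ (f e) else 𝟙)
subst-fold-if σ {zero} b f = refl
subst-fold-if σ {suc n} b f = cong₂ _⊗_ (subst-if (b zero)) (subst-fold-if σ (b ∘ suc) (f ∘ suc))
  where
  subst-if : ∀ c → subst σ (if c then f zero else 𝟙) ≡ (if c then subst σ (f zero) else 𝟙)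
  subst-if false = refl
  subst-if true = refl

module _ {Z : Set} where

  toGate : ∀ {k} → Label Z → (Fin k → Bool) → Gate Z k
  toGate (lInput z) _ = input z
  toGate (lConst b) _ = const b
  toGate lPlus S = plus S
  toGate lTimes S = times S

  hasChildren : Label Z → Bool
  hasChildren (lInput _) = false
  hasChildren (lConst _) = false
  hasChildren lPlus = true
  hasChildren lTimes = true

  hasChildren-mapLabel : ∀ ρ l → hasChildren (mapLabel ρ l) ≡ hasChildren l
  hasChildren-mapLabel ρ (lInput _) = refl
  hasChildren-mapLabel ρ (lConst _) = refl
  hasChildren-mapLabel ρ lPlus = refl
  hasChildren-mapLabel ρ lTimes = refl

  -- Gate i of  build N L C  has label L i and children {j | i < j, C i j}; gate 0 is the output.
  build : (N : ℕ) → (Fin N → Label Z) → (Fin N → Fin N → Bool) → Circuit Z N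
  build zero L C = []
  build (suc N) L C = build N (L ∘ suc) (λ i j → C (suc i) (suc j)) ▷ toGate (L zero) (C zero ∘ suc)

  labelOf-build : ∀ N L C i → labelOf (build N L C) i ≡ L i
  labelOf-build (suc N) L C zero with L zero
  ... | lInput _ = refl
  ... | lConst _ = refl
  ... | lPlus = refl
  ... | lTimes = refl
  labelOf-build (suc N) L C (suc i) = labelOf-build N (L ∘ suc) _ i

  childOf-build : ∀ N L C i j → childOf (build N L C) i j ≡ does (i <? j) ∧ (hasChildren (L i) ∧ C i j)
  childOf-build (suc N) L C zero zero = refl
  childOf-build (suc N) L C zero (suc j) with L zero
  ... | lInput _ = refl
  ... | lConst _ = refl
  ... | lPlus = refl
  ... | lTimes = refl
  childOf-build (suc N) L C (suc i) zero = refl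
  childOf-build (suc N) L C (suc i) (suc j) = childOf-build N (L ∘ suc) _ i j

  gateVal-build-input : ∀ N L C i {z} → L i ≡ lInput z → gateVal (build N L C) i ≡ var z
  gateVal-build-input (suc N) L C zero Li≡z rewrite Li≡z = refl
  gateVal-build-input (suc N) L C (suc i) Li≡z = gateVal-build-input N (L ∘ suc) _ i Li≡z

  gateVal-build-plus : ∀ N L C i → L i ≡ lPlus →
    gateVal (build N L C) i ≈ sumFin (λ j → if does (i <? j) ∧ C i j then gateVal (build N L C) j else 𝟘)
  gateVal-build-plus (suc N) L C zero Li≡+ rewrite Li≡+ = sym≈ (Poly.+-identityˡ _)
  gateVal-build-plus (suc N) L C (suc i) Li≡+ =
    trans≈ (gateVal-build-plus N (L ∘ suc) _ i Li≡+) (sym≈ (Poly.+-identityˡ _))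

  gateVal-build-times : ∀ N L C i → L i ≡ lTimes →
    gateVal (build N L C) i ≈ prodFin (λ j → if does (i <? j) ∧ C i j then gateVal (build N L C) j else 𝟙)
  gateVal-build-times (suc N) L C zero Li≡* rewrite Li≡* = sym≈ (Poly.*-identityˡ _)
  gateVal-build-times (suc N) L C (suc i) Li≡* =
    trans≈ (gateVal-build-times N (L ∘ suc) _ i Li≡*) (sym≈ (Poly.*-identityˡ _))

  module DescribedCircuit (c : Code) (label : El c → Label Z) (child : El c → El c → Bool)
    (child⇒< : ∀ t t' → child t t' ≡ true → toℕ (encode c t) < toℕ (encode c t')) where

    circuit : Circuit Z (card c)
    circuit = build (card c) (label ∘ decode c) (λ i j → child (decode c i) (decode c j))

    value : El c → Expr Z
    value t = gateVal circuit (encode c t)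

    private
      guard : ∀ t t' b →
        does (encode c t <? encode c t') ∧ (b ∧ child (decode c (encode c t)) (decode c (encode c t'))) ≡ b ∧ child t t'
      guard t t' b rewrite decode-encode c t | decode-encode c t' with child t t' in eq
      ... | true rewrite dec-true (encode c t <? encode c t') (child⇒< t t' eq) = refl
      ... | false rewrite Bool.∧-zeroʳ b = Bool.∧-zeroʳ _

      label-encode : ∀ t → label (decode c (encode c t)) ≡ label t
      label-encode t = cong label (decode-encode c t)

    value-input : ∀ t {z} → label t ≡ lInput z → value t ≡ var z
    value-input t eq = gateVal-build-input (card c) _ _ (encode c t) (≡.trans (label-encode t) eq)

    value-plus : ∀ t → label t ≡ lPlus → value t ≈ ⨁.big c (λ t' → if child t t' then value t' else 𝟘)
    value-plus t eq =
      trans≈ (gateVal-build-plus (card c) _ _ (encode c t) (≡.trans (label-encode t) eq))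
      (trans≈ (sumFin≈fold _)
      (trans≈ (⨁.fold≈big c _)
              (⨁.big-cong c (λ t' → Poly.reflexive (cong (λ b → if b then value t' else 𝟘) (guard t t' true))))))

    value-times : ∀ t → label t ≡ lTimes → value t ≈ ⨂.big c (λ t' → if child t t' then value t' else 𝟙)
    value-times t eq =
      trans≈ (gateVal-build-times (card c) _ _ (encode c t) (≡.trans (label-encode t) eq))
      (trans≈ (prodFin≈fold _)
      (trans≈ (⨂.fold≈big c _)
              (⨂.big-cong c (λ t' → Poly.reflexive (cong (λ b → if b then value t' else 𝟙) (guard t t' true))))))

    labelOf-circuit : ∀ t → labelOf circuit (encode c t) ≡ label t
    labelOf-circuit t = ≡.trans (labelOf-build (card c) _ _ (encode c t)) (label-encode t)

    childOf-circuit : ∀ t t' → childOf circuit (encode c t) (encode c t') ≡ hasChildren (label t) ∧ child t t'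
    childOf-circuit t t' = ≡.trans (childOf-build (card c) _ _ (encode c t) (encode c t'))
      (≡.trans (cong (λ l → does (encode c t <? encode c t') ∧ (hasChildren l ∧ _)) (label-encode t))
               (guard t t' _))

    module Automorphism (ρ : Z → Z) (τ : El c → El c) (τ-involutive : ∀ t → τ (τ t) ≡ t)
      (label-τ : ∀ t → label (τ t) ≡ mapLabel ρ (label t))
      (child-τ : ∀ t t' → child (τ t) (τ t') ≡ child t t') where

      open ≡.≡-Reasoning

      σ : Fin (card c) → Fin (card c)
      σ i = encode c (τ (decode c i))

      σ-involutive : ∀ i → σ (σ i) ≡ i
      σ-involutive i rewrite decode-encode c (τ (decode c i)) | τ-involutive (decode c i) = encode-decode c i

      σ-inverse : Fin (card c) ↔ Fin (card c)
      σ-inverse = mk↔ₛ′ σ σ σ-involutive σ-involutive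

      σ-label : ∀ i → labelOf circuit (σ i) ≡ mapLabel ρ (labelOf circuit i)
      σ-label i = begin
        labelOf circuit (σ i)                 ≡⟨ labelOf-circuit (τ t) ⟩
        label (τ t)                           ≡⟨ label-τ t ⟩
        mapLabel ρ (label t)                  ≡⟨ cong (mapLabel ρ) (labelOf-build (card c) _ _ i) ⟨
        mapLabel ρ (labelOf circuit i)        ∎
        where t = decode c i

      σ-child : ∀ i j → childOf circuit (σ i) (σ j) ≡ childOf circuit i j
      σ-child i j = begin
        childOf circuit (σ i) (σ j)                       ≡⟨ childOf-circuit (τ t) (τ t') ⟩
        hasChildren (label (τ t)) ∧ child (τ t) (τ t')    ≡⟨ cong₂ _∧_ hasChildren-τ (child-τ t t') ⟩
        hasChildren (label t) ∧ child t t'                ≡⟨ childOf-circuit t t' ⟨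
        childOf circuit (encode c t) (encode c t')
          ≡⟨ cong₂ (childOf circuit) (encode-decode c i) (encode-decode c j) ⟩
        childOf circuit i j                               ∎
        where
        t = decode c i
        t' = decode c j
        hasChildren-τ : hasChildren (label (τ t)) ≡ hasChildren (label t)
        hasChildren-τ = ≡.trans (cong hasChildren (label-τ t)) (hasChildren-mapLabel ρ (label t))

module _ {V : Set} where

  open ≈-Reasoning {V}
  open SemiringSum (Poly.semiring {V}) using (*-distribˡ-sum)
  open CommutativeSemigroupProperties (Poly.*-commutativeSemigroup {V}) using (x∙yz≈y∙xz)

  cst⊗≈if : ∀ b (p : Expr V) → cst b ⊗ p ≈ (if b then p else 𝟘)
  cst⊗≈if false p = Poly.zeroˡ p
  cst⊗≈if true p = Poly.*-identityˡ p

  if-xor : ∀ b b' (p : Expr V) → (if b xor b' then p else 𝟘) ≈ (if b then p else 𝟘) ⊕ (if b' then p else 𝟘)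
  if-xor false b' p = sym≈ (Poly.+-identityˡ _)
  if-xor true false p = sym≈ (⊕-identity p)
  if-xor true true p = sym≈ (⊕-self p)

  prefixProduct : ∀ {n} → (Fin n → Expr V) → Fin n → Expr V
  prefixProduct a e = ⨂.fold (λ e' → if does (e' <? e) then a e' else 𝟙)

  telescope : ∀ {n} (a : Fin n → Expr V) → ⨁.fold (λ e → (a e ⊕ 𝟙) ⊗ prefixProduct a e) ≈ 𝟙 ⊕ ⨂.fold a
  telescope {zero} a = sym≈ (⊕-self 𝟙)
  telescope {suc n} a = begin
    (a₀ ⊕ 𝟙) ⊗ ⨂.fold {n = suc n} (λ _ → 𝟙) ⊕ ⨁.fold (λ e → (a (suc e) ⊕ 𝟙) ⊗ (a₀ ⊗ prefixProduct (a ∘ suc) e))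
      ≈⟨ cong⊕ (trans≈ (cong⊗ refl≈ (⨂.big-ε (fin (suc n)))) (⊗-identity _))
               (trans≈ (⨁.big-cong (fin n) (λ e → x∙yz≈y∙xz _ a₀ _)) (sym≈ (*-distribˡ-sum {n} a₀ _))) ⟩
    (a₀ ⊕ 𝟙) ⊕ a₀ ⊗ ⨁.fold (λ e → (a (suc e) ⊕ 𝟙) ⊗ prefixProduct (a ∘ suc) e)
      ≈⟨ cong⊕ refl≈ (cong⊗ refl≈ (telescope (a ∘ suc))) ⟩
    (a₀ ⊕ 𝟙) ⊕ a₀ ⊗ (𝟙 ⊕ ⨂.fold (a ∘ suc))
      ≈⟨ solve 2 (λ x p → (x :+ con true) :+ x :* (con true :+ p) := con true :+ x :* p)
               refl≈ a₀ (⨂.fold (a ∘ suc)) ⟩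
    𝟙 ⊕ a₀ ⊗ ⨂.fold (a ∘ suc)  ∎
    where a₀ = a zero

  private
    P = Polynomial {V = V} 7

    pick : P → P → Bool → P
    pick x y b = if b then y else x

    ∑bool : (Bool → P) → P
    ∑bool f = f false :+ (f true :+ con false)

    vertex-lhs vertex-rhs : Bool → (Bool → P) → (Bool → P) → (Bool → P) → P → P
    vertex-lhs a A B C S = ∑bool (λ i → ∑bool (λ j → ∑bool (λ k →
      (A i :+ B j :+ C k :+ con (i xor j xor k xor a)) :* (A (not i) :* (B (not j) :* (C (not k) :* S))))))
    vertex-rhs a A B C S = A false :* (sB :* (sC :* S)) :+ (B false :* (sA :* (sC :* S))
      :+ (C false :* (sA :* (sB :* S)) :+ con a :* (sA :* (sB :* (sC :* S)))))
      where
      sA = A false :+ A true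
      sB = B false :+ B true
      sC = C false :+ C true

  -- Summed over i, j, k, the literal part A i ⊕ B j ⊕ C k cancels in pairs (A i ⊗ A (not i) occurs
  -- twice), and the constant i xor j xor k xor a contributes one term per summand.
  vertex-identity : ∀ (A B C : Bool → Expr V) (S : Expr V) a →
    ⨁.big (bool ⊠ bool ⊠ bool) (λ { (i , j , k) →
      (A i ⊕ B j ⊕ C k ⊕ cst (i xor j xor k xor a)) ⊗ (A (not i) ⊗ (B (not j) ⊗ (C (not k) ⊗ S))) })
    ≈ let sA = A false ⊕ A true ; sB = B false ⊕ B true ; sC = C false ⊕ C true in
      A false ⊗ (sB ⊗ (sC ⊗ S)) ⊕ (B false ⊗ (sA ⊗ (sC ⊗ S)) ⊕ (C false ⊗ (sA ⊗ (sB ⊗ S))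
      ⊕ cst a ⊗ (sA ⊗ (sB ⊗ (sC ⊗ S)))))
  vertex-identity A B C S false = solve 7 (λ a₀ a₁ b₀ b₁ c₀ c₁ s →
      vertex-lhs false (pick a₀ a₁) (pick b₀ b₁) (pick c₀ c₁) s
      := vertex-rhs false (pick a₀ a₁) (pick b₀ b₁) (pick c₀ c₁) s)
    refl≈ (A false) (A true) (B false) (B true) (C false) (C true) S
  vertex-identity A B C S true = solve 7 (λ a₀ a₁ b₀ b₁ c₀ c₁ s →
      vertex-lhs true (pick a₀ a₁) (pick b₀ b₁) (pick c₀ c₁) s
      := vertex-rhs true (pick a₀ a₁) (pick b₀ b₁) (pick c₀ c₁) s)
    refl≈ (A false) (A true) (B false) (B true) (C false) (C true) S

module CFISystem (H : CubicConnGraph) where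

  private
    G = graph H
    NV = nV G
    NE = nE G

  open DecMembership (_≟_ {NE}) using (_∈?_; _∉?_)

  e₀ e₁ e₂ : Fin NV → Fin NE
  e₀ v = inc (cubic H) v zero
  e₁ v = inc (cubic H) v (suc zero)
  e₂ v = inc (cubic H) v (suc (suc zero))

  edges : Fin NV → List (Fin NE)
  edges v = e₀ v ∷ e₁ v ∷ e₂ v ∷ []

  edges-unique : ∀ v → Unique (edges v)
  edges-unique v = (distinct (λ ()) ∷ distinct (λ ()) ∷ []) ∷ (distinct (λ ()) ∷ []) ∷ [] ∷ []
    where
    distinct : ∀ {k k'} → k ≢ k' → inc (cubic H) v k ≢ inc (cubic H) v k'
    distinct k≢k' eq = k≢k' (inc-inj (cubic H) v eq)

  ∈-edges⇔incident : ∀ v e → e ∈ edges v ⇔ (v ≡ proj₁ (ends G e) ⊎ v ≡ proj₂ (ends G e))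
  ∈-edges⇔incident v e = mk⇔ to from
    where
    incident : ∀ {e} → Incident G v e → v ≡ proj₁ (ends G e) ⊎ v ≡ proj₂ (ends G e)
    incident (inj₁ p) = inj₁ (≡.sym p)
    incident (inj₂ p) = inj₂ (≡.sym p)
    to : e ∈ edges v → v ≡ proj₁ (ends G e) ⊎ v ≡ proj₂ (ends G e)
    to (here refl) = incident (inc-sound (cubic H) v _)
    to (there (here refl)) = incident (inc-sound (cubic H) v _)
    to (there (there (here refl))) = incident (inc-sound (cubic H) v _)
    from : v ≡ proj₁ (ends G e) ⊎ v ≡ proj₂ (ends G e) → e ∈ edges v
    from incident with inc-complete (cubic H) v e (⊎-map ≡.sym ≡.sym incident)
    ... | zero , refl = here refl
    ... | suc zero , refl = there (here refl)
    ... | suc (suc zero) , refl = there (there (here refl))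

  ∈-edges-xor : ∀ v e → does (e ∈? edges v) ≡ does (v ≟ proj₁ (ends G e)) xor does (v ≟ proj₂ (ends G e))
  ∈-edges-xor v e = ≡.trans (does-⇔ (∈-edges⇔incident v e) (e ∈? edges v) (v ≟ x ⊎-dec v ≟ y)) ∨≡xor
    where
    x = proj₁ (ends G e)
    y = proj₂ (ends G e)
    -- The endpoints of an edge are distinct, so the disjunction is exclusive.
    ∨≡xor : does (v ≟ x) ∨ does (v ≟ y) ≡ does (v ≟ x) xor does (v ≟ y)
    ∨≡xor with v ≟ x | v ≟ y
    ... | yes v≡x | yes v≡y = ⊥-elim (loopless G e (≡.trans (≡.sym v≡x) v≡y))
    ... | yes _ | no _ = refl
    ... | no _ | _ = refl

  -- Each edge is counted once at each of its two endpoints, and h e ⊕ h e ≈ 𝟘.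
  handshake : ∀ {V} (h : Fin NE → Expr V) → ⨁.fold (λ v → foldr _⊕_ 𝟘 (map h (edges v))) ≈ 𝟘
  handshake h = begin
    ⨁.fold (λ v → foldr _⊕_ 𝟘 (map h (edges v)))
      ≈⟨ ⨁.big-cong (fin NV) (λ v → ⨁.big-∈ (fin NE) (edges-unique v) h) ⟨
    ⨁.fold (λ v → ⨁.fold (λ e → if does (e ∈? edges v) then h e else 𝟘))
      ≈⟨ ⨁.fold-comm {m = NV} {n = NE} _ ⟩
    ⨁.fold (λ e → ⨁.fold (λ v → if does (e ∈? edges v) then h e else 𝟘))
      ≈⟨ ⨁.big-cong (fin NE) counted-twice ⟩
    ⨁.fold (λ e → h e ⊕ h e)
      ≈⟨ ⨁.big-cong (fin NE) (λ e → ⊕-self (h e)) ⟩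
    ⨁.fold {n = NE} (λ _ → 𝟘)
      ≈⟨ ⨁.big-ε (fin NE) ⟩
    𝟘 ∎
    where
    open ≈-Reasoning
    counted-twice : ∀ e → ⨁.fold (λ v → if does (e ∈? edges v) then h e else 𝟘) ≈ h e ⊕ h e
    counted-twice e = begin
      ⨁.fold (λ v → if does (e ∈? edges v) then h e else 𝟘)
        ≈⟨ ⨁.big-cong (fin NV) (λ v → Poly.reflexive (cong (λ b → if b then h e else 𝟘) (∈-edges-xor v e))) ⟩
      ⨁.fold (λ v → if does (v ≟ x) xor does (v ≟ y) then h e else 𝟘)
        ≈⟨ ⨁.big-cong (fin NV) (λ v → if-xor (does (v ≟ x)) (does (v ≟ y)) (h e)) ⟩
      ⨁.fold (λ v → (if does (v ≟ x) then h e else 𝟘) ⊕ (if does (v ≟ y) then h e else 𝟘))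
        ≈⟨ ⨁.big-∙ (fin NV) _ _ ⟩
      ⨁.fold (λ v → if does (v ≟ x) then h e else 𝟘) ⊕ ⨁.fold (λ v → if does (v ≟ y) then h e else 𝟘)
        ≈⟨ cong⊕ (⨁.big-point (fin NV) x (λ _ → h e)) (⨁.big-point (fin NV) y (λ _ → h e)) ⟩
      h e ⊕ h e ∎
      where
      x = proj₁ (ends G e)
      y = proj₂ (ends G e)

  literalCode vertexCode : Code
  literalCode = fin NE ⊠ bool
  vertexCode = fin NV ⊠ bool ⊠ bool ⊠ bool

  vertexAxiom : El vertexCode → Ax H
  vertexAxiom (v , i , j , k) = vtxAx v i j k

  axiomsAt : Fin NV → List (Ax H)
  axiomsAt v = concatMap (λ i → concatMap (λ j → map (vtxAx v i j) (bools H)) (bools H)) (bools H)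

  vertexAxioms edgeAxioms booleanAxioms : List (Ax H)
  vertexAxioms = concatMap axiomsAt (allFin NV)
  edgeAxioms = map edgAx (allFin NE)
  booleanAxioms = concatMap (λ e → map (booAx e) (bools H)) (allFin NE)

  allAx-sum : ∀ {V} (F : Ax H → Expr V) → (∀ e b → F (booAx e b) ≈ 𝟘) →
              sumList F (allAx H) ≈ ⨁.big vertexCode (F ∘ vertexAxiom) ⊕ ⨁.fold (F ∘ edgAx)
  allAx-sum F boolean≈𝟘 = begin
    sumList F (vertexAxioms ++ edgeAxioms ++ booleanAxioms)
      ≈⟨ sumList-++ F vertexAxioms _ ⟩
    sumList F vertexAxioms ⊕ sumList F (edgeAxioms ++ booleanAxioms)
      ≈⟨ cong⊕ refl≈ (sumList-++ F edgeAxioms booleanAxioms) ⟩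
    sumList F vertexAxioms ⊕ (sumList F edgeAxioms ⊕ sumList F booleanAxioms)
      ≈⟨ cong⊕ vertex-part (trans≈ (cong⊕ edge-part boolean-part) (⊕-identity _)) ⟩
    ⨁.big vertexCode (F ∘ vertexAxiom) ⊕ ⨁.fold (F ∘ edgAx) ∎
    where
    open ≈-Reasoning
    vertex-part : sumList F vertexAxioms ≈ ⨁.big vertexCode (F ∘ vertexAxiom)
    vertex-part = trans≈ (sumList-concatMap F axiomsAt (allFin NV))
      (trans≈ (sumList-tabulate (sumList F ∘ axiomsAt) id) (⨁.big-cong (fin NV) λ v →
        trans≈ (sumList-concatMap F (λ i → concatMap (λ j → map (vtxAx v i j) (bools H)) (bools H)) (bools H))
               (sumList-cong (bools H) λ i → sumList-concatMap F (λ j → map (vtxAx v i j) (bools H)) (bools H))))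
    edge-part : sumList F edgeAxioms ≈ ⨁.fold (F ∘ edgAx)
    edge-part = trans≈ (Poly.reflexive (sumList-map F edgAx (allFin NE))) (sumList-tabulate (F ∘ edgAx) id)
    boolean-part : sumList F booleanAxioms ≈ 𝟘
    boolean-part = trans≈ (sumList-concatMap F _ (allFin NE))
      (sumList-zero _ (allFin NE) λ e → sumList-zero (F ∘ booAx e) (bools H) (boolean≈𝟘 e))

  module Witness {V : Set} (lit : XVar H → Expr V) where

    edgeSum : Fin NE → Expr V
    edgeSum e = lit (e , false) ⊕ lit (e , true)

    avoiding : List (Fin NE) → Expr V
    avoiding es = ⨂.fold (λ e → if does (e ∉? es) then edgeSum e else 𝟙)

    coefficient : Ax H → Expr V
    coefficient (vtxAx v i j k) =
      lit (e₀ v , not i) ⊗ (lit (e₁ v , not j) ⊗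
        (lit (e₂ v , not k) ⊗ avoiding (edges v)))
    coefficient (edgAx e) = prefixProduct edgeSum e
    coefficient (booAx _ _) = 𝟘

  module Certificate (u : Fin NV) where

    open Witness var
    open ≈-Reasoning

    endpointTerm : Fin NE → Expr (XVar H)
    endpointTerm e = var (e , false) ⊗ avoiding (e ∷ [])

    vertex-contribution : ∀ v →
      ⨁.big (bool ⊠ bool ⊠ bool) (λ { (i , j , k) → cfiPoly H u true (vtxAx v i j k) ⊗ coefficient (vtxAx v i j k) })
      ≈ foldr _⊕_ 𝟘 (map endpointTerm (edges v)) ⊕ cst ⌊ v ≟ u ⌋ ⊗ avoiding []
    vertex-contribution v with edges-unique v
    ... | (a≢b ∷ a≢c ∷ []) ∷ (b≢c ∷ []) ∷ [] ∷ [] = begin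
      _ ≈⟨ vertex-identity (λ i → var (a , i)) (λ j → var (b , j)) (λ k → var (c , k)) M ⌊ v ≟ u ⌋ ⟩
      var (a , false) ⊗ (edgeSum b ⊗ (edgeSum c ⊗ M))
        ⊕ (var (b , false) ⊗ (edgeSum a ⊗ (edgeSum c ⊗ M))
        ⊕ (var (c , false) ⊗ (edgeSum a ⊗ (edgeSum b ⊗ M))
        ⊕ cst ⌊ v ≟ u ⌋ ⊗ (edgeSum a ⊗ (edgeSum b ⊗ (edgeSum c ⊗ M)))))
        ≈⟨ cong⊕ (cong⊗ refl≈ all-but-a) (cong⊕ (cong⊗ refl≈ all-but-b)
                 (cong⊕ (cong⊗ refl≈ all-but-c) (cong⊗ refl≈ all))) ⟩
      endpointTerm a ⊕ (endpointTerm b ⊕ (endpointTerm c ⊕ cst ⌊ v ≟ u ⌋ ⊗ avoiding []))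
        ≈⟨ solve 4 (λ x y z w → x :+ (y :+ (z :+ w)) := (x :+ (y :+ (z :+ con false))) :+ w) refl≈ _ _ _ _ ⟩
      foldr _⊕_ 𝟘 (map endpointTerm (edges v)) ⊕ cst ⌊ v ≟ u ⌋ ⊗ avoiding [] ∎
      where
      a = e₀ v
      b = e₁ v
      c = e₂ v
      M = avoiding (edges v)
      all-but-a : edgeSum b ⊗ (edgeSum c ⊗ M) ≈ avoiding (a ∷ [])
      all-but-a = sym≈ (⨂.big-∉-singleton (fin NE) a≢b a≢c b≢c (↭-reverse (edges v)) edgeSum)
      all-but-b : edgeSum a ⊗ (edgeSum c ⊗ M) ≈ avoiding (b ∷ [])
      all-but-b = sym≈ (⨂.big-∉-singleton (fin NE) (≢-sym a≢b) b≢c a≢c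
                          (↭-trans (swap c a ↭-refl) (prep a (swap c b ↭-refl))) edgeSum)
      all-but-c : edgeSum a ⊗ (edgeSum b ⊗ M) ≈ avoiding (c ∷ [])
      all-but-c = sym≈ (⨂.big-∉-singleton (fin NE) (≢-sym a≢c) (≢-sym b≢c) a≢b (swap b a ↭-refl) edgeSum)
      all : edgeSum a ⊗ (edgeSum b ⊗ (edgeSum c ⊗ M)) ≈ avoiding []
      all = sym≈ (trans≈ (⨂.big-∉-∷ (fin NE) {y = a} {xs = []} (λ ()) edgeSum) (cong⊗ refl≈ (sym≈ all-but-a)))

    vertex-axioms-sum :
      ⨁.big vertexCode (λ p → cfiPoly H u true (vertexAxiom p) ⊗ coefficient (vertexAxiom p)) ≈ avoiding []
    vertex-axioms-sum = begin
      ⨁.big vertexCode (λ p → cfiPoly H u true (vertexAxiom p) ⊗ coefficient (vertexAxiom p))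
        ≈⟨ ⨁.big-cong (fin NV) vertex-contribution ⟩
      ⨁.fold (λ v → foldr _⊕_ 𝟘 (map endpointTerm (edges v)) ⊕ cst ⌊ v ≟ u ⌋ ⊗ avoiding [])
        ≈⟨ ⨁.big-∙ (fin NV) _ _ ⟩
      ⨁.fold (λ v → foldr _⊕_ 𝟘 (map endpointTerm (edges v))) ⊕ ⨁.fold (λ v → cst ⌊ v ≟ u ⌋ ⊗ avoiding [])
        ≈⟨ cong⊕ (handshake endpointTerm) (⨁.big-cong (fin NV) (λ v → cst⊗≈if _ _)) ⟩
      𝟘 ⊕ ⨁.fold (λ v → if ⌊ v ≟ u ⌋ then avoiding [] else 𝟘)
        ≈⟨ Poly.+-identityˡ _ ⟩
      ⨁.fold (λ v → if ⌊ v ≟ u ⌋ then avoiding [] else 𝟘)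
        ≈⟨ ⨁.big-cong (fin NV) (λ v → Poly.reflexive
             (cong (λ b → if b then avoiding [] else 𝟘) (isYes≗does (v ≟ u)))) ⟩
      ⨁.fold (λ v → if does (v ≟ u) then avoiding [] else 𝟘)
        ≈⟨ ⨁.big-point (fin NV) u (λ _ → avoiding []) ⟩
      avoiding [] ∎

    edge-axioms-sum : ⨁.fold (λ e → cfiPoly H u true (edgAx e) ⊗ coefficient (edgAx e)) ≈ 𝟙 ⊕ avoiding []
    edge-axioms-sum = telescope edgeSum

    axioms-sum : sumList (λ y → cfiPoly H u true y ⊗ coefficient y) (allAx H) ≈ 𝟙
    axioms-sum = begin
      sumList (λ y → cfiPoly H u true y ⊗ coefficient y) (allAx H)
        ≈⟨ allAx-sum _ (λ e b → Poly.zeroʳ _) ⟩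
      _ ≈⟨ cong⊕ vertex-axioms-sum edge-axioms-sum ⟩
      avoiding [] ⊕ (𝟙 ⊕ avoiding [])
        ≈⟨ solve 1 (λ p → p :+ (con true :+ p) := con true) refl≈ (avoiding []) ⟩
      𝟙 ∎

  subst-coefficient : ∀ {V W : Set} (lit : XVar H → Expr V) (σ : V → Expr W) y →
    subst σ (Witness.coefficient lit y) ≡ Witness.coefficient (subst σ ∘ lit) y
  subst-coefficient lit σ (vtxAx v i j k)
    rewrite subst-fold-if σ (λ e → does (e ∉? edges v)) (Witness.edgeSum lit) = refl
  subst-coefficient lit σ (edgAx e) = subst-fold-if σ (λ e' → does (e' <? e)) (Witness.edgeSum lit)
  subst-coefficient lit σ (booAx _ _) = refl

xor-cancelʳ : ∀ a b → (a xor b) xor b ≡ a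
xor-cancelʳ a b =
  ≡.trans (Bool.xor-assoc a b b) (≡.trans (cong (a xor_) (Bool.xor-same b)) (Bool.xor-identityʳ a))

involutive⇒injective : ∀ {A : Set} {f : A → A} → (∀ x → f (f x) ≡ x) → ∀ {x y} → f x ≡ f y → x ≡ y
involutive⇒injective {f = f} f-involutive {x} {y} fx≡fy =
  ≡.trans (≡.sym (f-involutive x)) (≡.trans (cong f fx≡fy) (f-involutive y))

module CFIRefutation (H : CubicConnGraph) (u : Fin (nV (graph H))) where

  private
    NV = nV (graph H)
    NE = nE (graph H)
    Z = XVar H ⊎ Ax H

  open CFISystem H

  open DecMembership (_≟_ {NE}) using (_∉?_)
  open DecMembership (≟ᶜ literalCode) using () renaming (_∈?_ to _∈ˣ?_)

  gateCode : Code
  gateCode = fin 1 ⊞ vertexCode ⊞ fin NE ⊞ fin NE ⊞ vertexCode ⊞ fin NE ⊞ literalCode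

  pattern output = inj₁ zero
  pattern vertexTerm p = inj₂ (inj₁ p)
  pattern edgeTerm e = inj₂ (inj₂ (inj₁ e))
  pattern edgeSum e = inj₂ (inj₂ (inj₂ (inj₁ e)))
  pattern vertexAxiomGate p = inj₂ (inj₂ (inj₂ (inj₂ (inj₁ p))))
  pattern edgeAxiomGate e = inj₂ (inj₂ (inj₂ (inj₂ (inj₂ (inj₁ e)))))
  pattern literal x = inj₂ (inj₂ (inj₂ (inj₂ (inj₂ (inj₂ x)))))

  label : El gateCode → Label Z
  label output = lPlus
  label (vertexTerm _) = lTimes
  label (edgeTerm _) = lTimes
  label (edgeSum _) = lPlus
  label (vertexAxiomGate p) = lInput (inj₂ (vertexAxiom p))
  label (edgeAxiomGate e) = lInput (inj₂ (edgAx e))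
  label (literal x) = lInput (inj₁ x)

  oppositeLiterals : El vertexCode → List (XVar H)
  oppositeLiterals (v , i , j , k) = (e₀ v , not i) ∷ (e₁ v , not j) ∷ (e₂ v , not k) ∷ []

  wire : El gateCode → El gateCode → Bool
  wire output (vertexTerm _) = true
  wire output (edgeTerm _) = true
  wire (vertexTerm (v , _)) (edgeSum e) = does (e ∉? edges v)
  wire (vertexTerm p) (vertexAxiomGate q) = does (≟ᶜ vertexCode q p)
  wire (vertexTerm p) (literal x) = does (x ∈ˣ? oppositeLiterals p)
  wire (edgeTerm e) (edgeSum e') = does (e' <? e)
  wire (edgeTerm e) (edgeAxiomGate e') = does (e' ≟ e)
  wire (edgeSum e) (literal (e' , _)) = does (e' ≟ e)
  wire _ _ = false

  -- Guarding by the block order makes every wire point to a later gate by construction.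
  child : El gateCode → El gateCode → Bool
  child t t' = (spine gateCode t <ᵇ spine gateCode t') ∧ wire t t'

  child⇒< : ∀ t t' → child t t' ≡ true → toℕ (encode gateCode t) < toℕ (encode gateCode t')
  child⇒< t t' eq with spine gateCode t <ᵇ spine gateCode t' in earlier
  child⇒< t t' eq | true = spine-< gateCode t t' (ℕ.<ᵇ⇒< _ _ (≡.subst T (≡.sym earlier) _))
  child⇒< t t' () | false

  open DescribedCircuit gateCode label child child⇒< public

  x̂ : XVar H → Expr Z
  x̂ = var ∘ inj₁

  module W = Witness x̂

  value-literal : ∀ x → value (literal x) ≡ x̂ x
  value-literal x = value-input (literal x) refl

  value-edgeSum : ∀ e → value (edgeSum e) ≈ W.edgeSum e
  value-edgeSum e = trans≈ (value-plus (edgeSum e) refl)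
    (skip (fin 1) (skip vertexCode (skip (fin NE) (skip (fin NE) (skip vertexCode (skip (fin NE) (begin
      ⨁.big literalCode (λ { (e' , b) → if does (e' ≟ e) then value (literal (e' , b)) else 𝟘 })
        ≈⟨ ⨁.big-cong (fin NE) (λ e' → ⨁.big-if bool (does (e' ≟ e)) (λ b → value (literal (e' , b)))) ⟩
      ⨁.fold (λ e' → if does (e' ≟ e) then ⨁.big bool (λ b → value (literal (e' , b))) else 𝟘)
        ≈⟨ ⨁.big-point (fin NE) e _ ⟩
      value (literal (e , false)) ⊕ (value (literal (e , true)) ⊕ 𝟘)
        ≈⟨ Poly.reflexive (cong₂ (λ p q → p ⊕ (q ⊕ 𝟘)) (value-literal _) (value-literal _)) ⟩
      x̂ (e , false) ⊕ (x̂ (e , true) ⊕ 𝟘)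
        ≈⟨ cong⊕ refl≈ (⊕-identity _) ⟩
      W.edgeSum e ∎)))))))
    where
    open ≈-Reasoning
    skip = ⨁.big-ε-∙

  avoiding-value : ∀ es → ⨂.fold (λ e → if does (e ∉? es) then value (edgeSum e) else 𝟙) ≈ W.avoiding es
  avoiding-value es = ⨂.big-cong (fin NE) (λ e → if-cong (does (e ∉? es)) (value-edgeSum e))

  value-vertexTerm : ∀ p → value (vertexTerm p) ≈ var (inj₂ (vertexAxiom p)) ⊗ W.coefficient (vertexAxiom p)
  value-vertexTerm p@(v , i , j , k) = trans≈ (value-times (vertexTerm p) refl)
    (skip (fin 1) (skip vertexCode (skip (fin NE) (begin
      M′ ⊗ (y′ ⊗ (⨂.big (fin NE) (λ _ → 𝟙) ⊗ L′))
        ≈⟨ cong⊗ (avoiding-value (edges v)) (cong⊗ y′≈y (skip (fin NE) L′≈L)) ⟩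
      W.avoiding (edges v) ⊗ (y ⊗ (x̂ l₀ ⊗ (x̂ l₁ ⊗ (x̂ l₂ ⊗ 𝟙))))
        ≈⟨ solve 5 (λ m y a b c → m :* (y :* (a :* (b :* (c :* con true)))) := y :* (a :* (b :* (c :* m))))
                   refl≈ _ _ _ _ _ ⟩
      y ⊗ W.coefficient (vertexAxiom p) ∎))))
    where
    open ≈-Reasoning
    skip = ⨂.big-ε-∙
    y = var (inj₂ (vertexAxiom p))
    l₀ = (e₀ v , not i)
    l₁ = (e₁ v , not j)
    l₂ = (e₂ v , not k)
    M′ = ⨂.fold (λ e → if does (e ∉? edges v) then value (edgeSum e) else 𝟙)
    y′ = ⨂.big vertexCode (λ q → if does (≟ᶜ vertexCode q p) then value (vertexAxiomGate q) else 𝟙)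
    L′ = ⨂.big literalCode (λ x → if does (x ∈ˣ? oppositeLiterals p) then value (literal x) else 𝟙)
    y′≈y : y′ ≈ y
    y′≈y = trans≈ (⨂.big-point vertexCode p (value ∘ vertexAxiomGate))
                  (Poly.reflexive (value-input (vertexAxiomGate p) refl))
    L′≈L : L′ ≈ x̂ l₀ ⊗ (x̂ l₁ ⊗ (x̂ l₂ ⊗ 𝟙))
    L′≈L = trans≈ (⨂.big-∈ literalCode {xs = oppositeLiterals p} (Unique.map⁻ {f = proj₁} (edges-unique v))
                           (value ∘ literal))
      (Poly.reflexive (cong₂ _⊗_ (value-literal l₀) (cong₂ _⊗_ (value-literal l₁)
                                                      (cong₂ _⊗_ (value-literal l₂) refl))))

  value-edgeTerm : ∀ e → value (edgeTerm e) ≈ var (inj₂ (edgAx e)) ⊗ W.coefficient (edgAx e)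
  value-edgeTerm e = trans≈ (value-times (edgeTerm e) refl)
    (skip (fin 1) (skip vertexCode (skip (fin NE) (begin
      P′ ⊗ (⨂.big vertexCode (λ _ → 𝟙) ⊗ (y′ ⊗ ⨂.big literalCode (λ _ → 𝟙)))
        ≈⟨ cong⊗ prefix-value (skip vertexCode (cong⊗ y′≈y (⨂.big-ε literalCode))) ⟩
      W.coefficient (edgAx e) ⊗ (y ⊗ 𝟙)
        ≈⟨ solve 2 (λ p y → p :* (y :* con true) := y :* p) refl≈ _ _ ⟩
      y ⊗ W.coefficient (edgAx e) ∎))))
    where
    open ≈-Reasoning
    skip = ⨂.big-ε-∙
    y = var (inj₂ (edgAx e))
    P′ = ⨂.fold (λ e' → if does (e' <? e) then value (edgeSum e') else 𝟙)
    prefix-value : P′ ≈ W.coefficient (edgAx e)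
    prefix-value = ⨂.big-cong (fin NE) (λ e' → if-cong (does (e' <? e)) (value-edgeSum e'))
    y′ = ⨂.fold (λ e' → if does (e' ≟ e) then value (edgeAxiomGate e') else 𝟙)
    y′≈y : y′ ≈ y
    y′≈y = trans≈ (⨂.big-point (fin NE) e (value ∘ edgeAxiomGate))
                  (Poly.reflexive (value-input (edgeAxiomGate e) refl))

  value-output : value output ≈ sumList (λ y → var (inj₂ y) ⊗ W.coefficient y) (allAx H)
  value-output = trans≈ (value-plus output refl) (⨁.big-ε-∙ (fin 1) (begin
    ⨁.big vertexCode (value ∘ vertexTerm) ⊕ (⨁.fold (value ∘ edgeTerm) ⊕ rest)
      ≈⟨ cong⊕ (⨁.big-cong vertexCode value-vertexTerm)
               (trans≈ (cong⊕ (⨁.big-cong (fin NE) value-edgeTerm) rest≈𝟘) (⊕-identity _)) ⟩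
    ⨁.big vertexCode (λ p → var (inj₂ (vertexAxiom p)) ⊗ W.coefficient (vertexAxiom p))
      ⊕ ⨁.fold (λ e → var (inj₂ (edgAx e)) ⊗ W.coefficient (edgAx e))
      ≈⟨ allAx-sum _ (λ _ _ → Poly.zeroʳ _) ⟨
    sumList (λ y → var (inj₂ y) ⊗ W.coefficient y) (allAx H) ∎))
    where
    open ≈-Reasoning
    rest = ⨁.fold {n = NE} (λ _ → 𝟘)
           ⊕ (⨁.big vertexCode (λ _ → 𝟘) ⊕ (⨁.fold {n = NE} (λ _ → 𝟘) ⊕ ⨁.big literalCode (λ _ → 𝟘)))
    rest≈𝟘 : rest ≈ 𝟘
    rest≈𝟘 = ⨁.big-ε-∙ (fin NE) (⨁.big-ε-∙ vertexCode (⨁.big-ε-∙ (fin NE) (⨁.big-ε literalCode)))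

  module Symmetry (π : Fin NE → Bool) where

    flipVertex : El vertexCode → El vertexCode
    flipVertex (v , i , j , k) =
      v , i xor π (e₀ v) , j xor π (e₁ v) , k xor π (e₂ v)

    act : El gateCode → El gateCode
    act output = output
    act (vertexTerm p) = vertexTerm (flipVertex p)
    act (edgeTerm e) = edgeTerm e
    act (edgeSum e) = edgeSum e
    act (vertexAxiomGate p) = vertexAxiomGate (flipVertex p)
    act (edgeAxiomGate e) = edgeAxiomGate e
    act (literal x) = literal (actX H π x)

    flipVertex-involutive : ∀ p → flipVertex (flipVertex p) ≡ p
    flipVertex-involutive (v , i , j , k) =
      cong₂ (λ i′ jk → v , i′ , jk) (xor-cancelʳ i _) (cong₂ _,_ (xor-cancelʳ j _) (xor-cancelʳ k _))

    actX-involutive : ∀ x → actX H π (actX H π x) ≡ x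
    actX-involutive (e , b) = cong (e ,_) (xor-cancelʳ b (π e))

    flipVertex-injective : ∀ {p q} → flipVertex p ≡ flipVertex q → p ≡ q
    flipVertex-injective = involutive⇒injective flipVertex-involutive

    actX-injective : ∀ {x y} → actX H π x ≡ actX H π y → x ≡ y
    actX-injective = involutive⇒injective actX-involutive

    act-involutive : ∀ t → act (act t) ≡ t
    act-involutive output = refl
    act-involutive (vertexTerm p) = cong vertexTerm (flipVertex-involutive p)
    act-involutive (edgeTerm e) = refl
    act-involutive (edgeSum e) = refl
    act-involutive (vertexAxiomGate p) = cong vertexAxiomGate (flipVertex-involutive p)
    act-involutive (edgeAxiomGate e) = refl
    act-involutive (literal x) = cong literal (actX-involutive x)

    label-act : ∀ t → label (act t) ≡ mapLabel (actZ H π) (label t)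
    label-act output = refl
    label-act (vertexTerm _) = refl
    label-act (edgeTerm _) = refl
    label-act (edgeSum _) = refl
    label-act (vertexAxiomGate _) = refl
    label-act (edgeAxiomGate _) = refl
    label-act (literal _) = refl

    spine-act : ∀ t → spine gateCode (act t) ≡ spine gateCode t
    spine-act output = refl
    spine-act (vertexTerm _) = refl
    spine-act (edgeTerm _) = refl
    spine-act (edgeSum _) = refl
    spine-act (vertexAxiomGate _) = refl
    spine-act (edgeAxiomGate _) = refl
    spine-act (literal _) = refl

    oppositeLiterals-flip : ∀ p → oppositeLiterals (flipVertex p) ≡ map (actX H π) (oppositeLiterals p)
    oppositeLiterals-flip (v , i , j , k) =
      cong₂ _∷_ (flip-literal _ i) (cong₂ _∷_ (flip-literal _ j) (cong₂ _∷_ (flip-literal _ k) refl))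
      where
      flip-literal : ∀ e b → (e , not (b xor π e)) ≡ actX H π (e , not b)
      flip-literal e b = cong (e ,_) (Bool.not-distribˡ-xor b (π e))

    wire-act : ∀ t t' → wire (act t) (act t') ≡ wire t t'
    wire-act output output = refl
    wire-act output (vertexTerm _) = refl
    wire-act output (edgeTerm _) = refl
    wire-act output (edgeSum _) = refl
    wire-act output (vertexAxiomGate _) = refl
    wire-act output (edgeAxiomGate _) = refl
    wire-act output (literal _) = refl
    wire-act (vertexTerm p) output = refl
    wire-act (vertexTerm p) (vertexTerm _) = refl
    wire-act (vertexTerm p) (edgeTerm _) = refl
    wire-act (vertexTerm p) (edgeSum _) = refl
    wire-act (vertexTerm p) (vertexAxiomGate q) = does-≟-injective {c = vertexCode} flipVertex-injective q p
    wire-act (vertexTerm p) (edgeAxiomGate _) = refl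
    wire-act (vertexTerm p) (literal x) =
      ≡.trans (cong (λ ls → does (actX H π x ∈ˣ? ls)) (oppositeLiterals-flip p))
              (does-∈-map-injective {c = literalCode} actX-injective x (oppositeLiterals p))
    wire-act (edgeTerm e) output = refl
    wire-act (edgeTerm e) (vertexTerm _) = refl
    wire-act (edgeTerm e) (edgeTerm _) = refl
    wire-act (edgeTerm e) (edgeSum _) = refl
    wire-act (edgeTerm e) (vertexAxiomGate _) = refl
    wire-act (edgeTerm e) (edgeAxiomGate _) = refl
    wire-act (edgeTerm e) (literal _) = refl
    wire-act (edgeSum e) output = refl
    wire-act (edgeSum e) (vertexTerm _) = refl
    wire-act (edgeSum e) (edgeTerm _) = refl
    wire-act (edgeSum e) (edgeSum _) = refl
    wire-act (edgeSum e) (vertexAxiomGate _) = refl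
    wire-act (edgeSum e) (edgeAxiomGate _) = refl
    wire-act (edgeSum e) (literal _) = refl
    wire-act (vertexAxiomGate _) _ = refl
    wire-act (edgeAxiomGate _) _ = refl
    wire-act (literal _) _ = refl

    child-act : ∀ t t' → child (act t) (act t') ≡ child t t'
    child-act t t' rewrite spine-act t | spine-act t' | wire-act t t' = refl

    open Automorphism (actZ H π) act act-involutive label-act child-act public

  module W₀ = Witness var

  output-linear : value output ≈ sumList (λ y → var (inj₂ y) ⊗ subst x̂ (W₀.coefficient y)) (allAx H)
  output-linear = trans≈ value-output
    (sumList-cong (allAx H) λ y → cong⊗ refl≈ (Poly.reflexive (≡.sym (subst-coefficient var x̂ y))))

  -- The circuit is invariant under every edge flip π, not only under those in Γ.
  refutation : SymLinIPSRefutation H u true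
  refutation = record
    { s = card (vertexCode ⊞ fin NE ⊞ fin NE ⊞ vertexCode ⊞ fin NE ⊞ literalCode)
    ; circuit = circuit
    ; at-zero = trans≈ (subst-cong _ output-linear) (trans≈ (Poly.reflexive (subst-sumList _ _ (allAx H)))
        (sumList-zero _ (allAx H) (λ y → Poly.zeroˡ _)))
    ; at-axioms = trans≈ (subst-cong _ output-linear) (trans≈ (Poly.reflexive (subst-sumList _ _ (allAx H)))
        (trans≈ (sumList-cong (allAx H) λ y → cong⊗ refl≈ (Poly.reflexive (substitution-collapses y)))
                (Certificate.axioms-sum u)))
    ; y-linear = W₀.coefficient , output-linear
    ; symmetric = λ π _ → let open Symmetry π in σ-inverse , σ-label , σ-child , refl
    }
    where
    substitution-collapses : ∀ y → subst _ (subst x̂ (W₀.coefficient y)) ≡ W₀.coefficient y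
    substitution-collapses y = ≡.trans (subst-subst _ x̂ (W₀.coefficient y)) (subst-var (W₀.coefficient y))

length-concatMap-const : ∀ {A B : Set} (f : A → List B) k xs → (∀ x → length (f x) ≡ k) →
                         length (concatMap f xs) ≡ length xs * k
length-concatMap-const f k [] _ = refl
length-concatMap-const f k (x ∷ xs) |f|≡k =
  ≡.trans (List.length-++ (f x)) (cong₂ _+_ (|f|≡k x) (length-concatMap-const f k xs |f|≡k))

suc≤2^ : ∀ n → suc n ≤ 2 ^ n
suc≤2^ zero = s≤s z≤n
suc≤2^ (suc n) = begin
  1 + suc n       ≤⟨ ℕ.+-mono-≤ (ℕ.≤-trans (s≤s z≤n) (suc≤2^ n)) (suc≤2^ n) ⟩
  2 ^ n + 2 ^ n   ≡⟨ cong (2 ^ n +_) (ℕ.+-identityʳ (2 ^ n)) ⟨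
  2 ^ suc n       ∎
  where open ℕ.≤-Reasoning

module Counting (H : CubicConnGraph) where

  private
    G = graph H
    NV = nV G
    NE = nE G

  open CFISystem H

  -- Each vertex is recovered from its first edge together with the end of that edge it sits at.
  vertices≤2*edges : NV ≤ NE * 2
  vertices≤2*edges = Fin.injective⇒≤ {f = encode literalCode ∘ tag} λ {v} {w} eq → begin
    v                                       ≡⟨ end-tag v ⟨
    end (tag v)                             ≡⟨ cong end (decode-encode literalCode (tag v)) ⟨
    end (decode literalCode (encode literalCode (tag v))) ≡⟨ cong (end ∘ decode literalCode) eq ⟩
    end (decode literalCode (encode literalCode (tag w))) ≡⟨ cong end (decode-encode literalCode (tag w)) ⟩
    end (tag w)                             ≡⟨ end-tag w ⟩
    w                                       ∎
    where
    open ≡.≡-Reasoning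
    tag : Fin NV → Fin NE × Bool
    tag v = e₀ v , does (v ≟ proj₁ (ends G (e₀ v)))
    end : Fin NE × Bool → Fin NV
    end (e , true) = proj₁ (ends G e)
    end (e , false) = proj₂ (ends G e)
    end-tag : ∀ v → end (tag v) ≡ v
    end-tag v with v ≟ proj₁ (ends G (e₀ v)) | inc-sound (cubic H) v zero
    ... | yes v≡x | _ = ≡.sym v≡x
    ... | no v≢x | inj₁ x≡v = ⊥-elim (v≢x (≡.sym x≡v))
    ... | no _ | inj₂ y≡v = y≡v

  length-allAx : length (allAx H) ≡ NV * 8 + (NE + NE * 2)
  length-allAx = begin
    length (allAx H)  ≡⟨ List.length-++ vertexAxioms ⟩
    length vertexAxioms + length (edgeAxioms ++ booleanAxioms)
      ≡⟨ cong (length vertexAxioms +_) (List.length-++ edgeAxioms) ⟩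
    length vertexAxioms + (length edgeAxioms + length booleanAxioms)
      ≡⟨ cong₂ _+_ (length-concatMap-const axiomsAt 8 (allFin NV) (λ _ → refl))
                   (cong₂ _+_ (List.length-map edgAx (allFin NE)) (length-concatMap-const _ 2 (allFin NE) (λ _ → refl))) ⟩
    length (allFin NV) * 8 + (length (allFin NE) + length (allFin NE) * 2)
      ≡⟨ cong₂ (λ m n → m * 8 + (n + n * 2)) (List.length-tabulate {n = NV} id) (List.length-tabulate {n = NE} id) ⟩
    NV * 8 + (NE + NE * 2) ∎
    where
    open ≡.≡-Reasoning

  size-bound : ∀ u → size H (CFIRefutation.refutation H u) ≤ 37 * 2 ^ NE
  size-bound u = ℕ.⊔-lub (ℕ.≤-trans (ℕ.≤-reflexive (gates NV NE)) bound≤) (ℕ.≤-trans inputs≤ bound≤)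
    where
    open ℕ.≤-Reasoning
    bound = 1 + (16 * NV + 5 * NE)
    gates : ∀ V E → 1 + (V * 8 + (E + (E + (V * 8 + (E + E * 2))))) ≡ 1 + (16 * V + 5 * E)
    gates = solve-∀
    inputs≤ : 2 * NE + length (allAx H) ≤ bound
    inputs≤ = begin
      2 * NE + length (allAx H)            ≡⟨ cong (2 * NE +_) length-allAx ⟩
      2 * NE + (NV * 8 + (NE + NE * 2))    ≤⟨ ℕ.m≤n+m _ (1 + 8 * NV) ⟩
      1 + 8 * NV + (2 * NE + (NV * 8 + (NE + NE * 2)))  ≡⟨ rearrange NV NE ⟩
      bound ∎
      where
      rearrange : ∀ V E → 1 + 8 * V + (2 * E + (V * 8 + (E + E * 2))) ≡ 1 + (16 * V + 5 * E)
      rearrange = solve-∀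
    bound≤ : bound ≤ 37 * 2 ^ NE
    bound≤ = begin
      1 + (16 * NV + 5 * NE)          ≤⟨ ℕ.+-monoʳ-≤ 1 (ℕ.+-monoˡ-≤ (5 * NE) (ℕ.*-monoʳ-≤ 16 vertices≤2*edges)) ⟩
      1 + (16 * (NE * 2) + 5 * NE)    ≤⟨ ℕ.m≤n+m _ 36 ⟩
      36 + (1 + (16 * (NE * 2) + 5 * NE))  ≡⟨ rearrange NE ⟩
      37 * suc NE                     ≤⟨ ℕ.*-monoʳ-≤ 37 (suc≤2^ NE) ⟩
      37 * 2 ^ NE ∎
      where
      rearrange : ∀ E → 36 + (1 + (16 * (E * 2) + 5 * E)) ≡ 37 * suc E
      rearrange = solve-∀

theorem6p5 : (G : ℕ → CubicConnGraph) (u : (n : ℕ) → Fin (nV (graph (G n)))) →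
    ∃ λ c → (n : ℕ) → Σ (SymLinIPSRefutation (G n) (u n) true) λ R →
      size (G n) R ≤ c * 2 ^ nE (graph (G n))
theorem6p5 G u = 37 , λ n → CFIRefutation.refutation (G n) (u n) , Counting.size-bound (G n) (u n)
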